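{- Let $b$ and $n$ be natural numbers with $1<n<b$, and let $M$ be the $(n,b)$-mother graph. If $(d_1,d_2)$ is an edge of $M$, then there are integers $c_1,c_2$ with $0\leq c_1\leq n-1$ and $0\leq c_2\leq n-1$ such that $bc_2-c_1=nd_2-d_1$.
   Context: For a natural-number base $b>1$, the base-$b$ digits are the integers $0,1,\ldots,b-1$. For an integer $x$, $\lambda(x)$ denotes the least non-negative residue of $x$ modulo $b$. The $(n,b)$-mother graph $M$ is the directed graph whose vertices are the base-$b$ digits and whose edges are the ordered pairs $(d_1,d_2)$ of base-$b$ digits satisfying $\lambda\left(d_1+(b-n)d_2\right)\leq n-1$. -}

module Defs where

open import Data.Nat as ℕ using (ℕ; suc; _<_; _≤_; _∸_)
open import Data.Integer as ℤ using (ℤ; +_; _%ℕ_)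

-- λ b x : least non-negative residue of the integer x modulo b (b ≥ 1 via suc).
-- (For b = 0 the value is an arbitrary 0; never used since b > 1 in the theorem.)
leastRes : (b : ℕ) → ℤ → ℕ
leastRes ℕ.zero    x = 0
leastRes (suc b′) x = x %ℕ suc b′

MotherEdge : (n b d₁ d₂ : ℕ) → Set
MotherEdge n b d₁ d₂ =
  d₁ < b × d₂ < b ×
  leastRes b (+ d₁ ℤ.+ (+ b ℤ.- + n) ℤ.* + d₂) ≤ n ∸ 1
  where open import Data.Product using (_×_)

-- Write x = d₁ + (b − n) d₂ = r + q b with r = x mod b, so that the edge condition says r < n.
-- Then c₁ = r and c₂ = d₂ − q work: b (d₂ − q) − r = b d₂ − x = n d₂ − d₁.  Since d₁ < b we
-- have q ≤ d₂, and b (d₂ − q) ≤ n d₂ + r < n (d₂ + 1) ≤ n b gives d₂ − q < n.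
module Submission where

open import Defs
open import Data.Nat using (ℕ; _<_; _∸_)
open import Data.Integer using (ℤ; +_; _+_; _-_; _*_; _≤_)
open import Data.Product using (Σ; _×_; _,_)
open import Relation.Binary.PropositionalEquality using (_≡_)

open import Data.Nat as ℕ using (suc; z≤n; s≤s; NonZero)
open import Data.Nat.DivMod using (_%_; _/_; m≡m%n+[m/n]*n; m<n*o⇒m/o<n)
import Data.Nat.Properties as ℕₚ
import Data.Nat.Tactic.RingSolver as ℕ-Solver
open import Data.Integer using (+≤+)
import Data.Integer.Properties as ℤₚ
import Data.Integer.Tactic.RingSolver as ℤ-Solver
open import Relation.Binary.PropositionalEquality
  using (refl; sym; trans; cong; subst; module ≡-Reasoning)

mother-sum≡ : ∀ {n b} d₁ d₂ → n ℕ.≤ b →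
              + d₁ + (+ b - + n) * + d₂ ≡ + (d₁ ℕ.+ (b ∸ n) ℕ.* d₂)
mother-sum≡ {n} {b} d₁ d₂ n≤b = begin
  + d₁ + (+ b - + n) * + d₂     ≡⟨ cong (λ k → + d₁ + k * + d₂) b-n≡b∸n ⟩
  + d₁ + + (b ∸ n) * + d₂       ≡⟨ cong (_+_ (+ d₁)) (ℤₚ.pos-* (b ∸ n) d₂) ⟨
  + d₁ + + ((b ∸ n) ℕ.* d₂)     ≡⟨ ℤₚ.pos-+ d₁ ((b ∸ n) ℕ.* d₂) ⟨
  + (d₁ ℕ.+ (b ∸ n) ℕ.* d₂)     ∎
  where
  open ≡-Reasoning
  b-n≡b∸n : + b - + n ≡ + (b ∸ n)
  b-n≡b∸n = trans (ℤₚ.m-n≡m⊖n b n) (ℤₚ.⊖-≥ n≤b)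

quotient≤ : ∀ {b m d₁} d₂ .{{_ : NonZero b}} → d₁ < b → m ℕ.≤ b →
            (d₁ ℕ.+ m ℕ.* d₂) / b ℕ.≤ d₂
quotient≤ {b} {m} {d₁} d₂ d₁<b m≤b = ℕₚ.<⇒≤pred (m<n*o⇒m/o<n (begin-strict
  d₁ ℕ.+ m ℕ.* d₂   <⟨ ℕₚ.+-monoˡ-< (m ℕ.* d₂) d₁<b ⟩
  b ℕ.+ m ℕ.* d₂    ≤⟨ ℕₚ.+-monoʳ-≤ b (ℕₚ.*-monoˡ-≤ d₂ m≤b) ⟩
  b ℕ.+ b ℕ.* d₂    ≡⟨ cong (b ℕ.+_) (ℕₚ.*-comm b d₂) ⟩
  suc d₂ ℕ.* b      ∎))
  where open ℕₚ.≤-Reasoning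

remainder-balance : ∀ {m n b d₁ d₂ e q r} → m ℕ.+ n ≡ b → e ℕ.+ q ≡ d₂ →
                    r ℕ.+ q ℕ.* b ≡ d₁ ℕ.+ m ℕ.* d₂ → b ℕ.* e ℕ.+ d₁ ≡ n ℕ.* d₂ ℕ.+ r
remainder-balance {m} {n} {_} {d₁} {_} {e} {q} {r} refl refl h =
  ℕₚ.+-cancelʳ-≡ (r ℕ.+ q ℕ.* (m ℕ.+ n)) _ _ (begin
    ((m ℕ.+ n) ℕ.* e ℕ.+ d₁) ℕ.+ (r ℕ.+ q ℕ.* (m ℕ.+ n))   ≡⟨ regroup m n d₁ e q r ⟩
    (n ℕ.* (e ℕ.+ q) ℕ.+ r) ℕ.+ (d₁ ℕ.+ m ℕ.* (e ℕ.+ q))   ≡⟨ cong (n ℕ.* (e ℕ.+ q) ℕ.+ r ℕ.+_) h ⟨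
    (n ℕ.* (e ℕ.+ q) ℕ.+ r) ℕ.+ (r ℕ.+ q ℕ.* (m ℕ.+ n))   ∎)
  where
  open ≡-Reasoning
  regroup : ∀ m n d₁ e q r →
            ((m ℕ.+ n) ℕ.* e ℕ.+ d₁) ℕ.+ (r ℕ.+ q ℕ.* (m ℕ.+ n)) ≡
            (n ℕ.* (e ℕ.+ q) ℕ.+ r) ℕ.+ (d₁ ℕ.+ m ℕ.* (e ℕ.+ q))
  regroup = ℕ-Solver.solve-∀

cofactor< : ∀ {b n d₁ d₂ e r} → b ℕ.* e ℕ.+ d₁ ≡ n ℕ.* d₂ ℕ.+ r → r < n → d₂ < b → e < n
cofactor< {b} {n} {d₁} {d₂} {e} {r} h r<n d₂<b = ℕₚ.*-cancelˡ-< b e n (begin-strict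
  b ℕ.* e             ≤⟨ ℕₚ.m≤m+n (b ℕ.* e) d₁ ⟩
  b ℕ.* e ℕ.+ d₁      ≡⟨ h ⟩
  n ℕ.* d₂ ℕ.+ r      <⟨ ℕₚ.+-monoʳ-< (n ℕ.* d₂) r<n ⟩
  n ℕ.* d₂ ℕ.+ n      ≡⟨ ℕₚ.+-comm (n ℕ.* d₂) n ⟩
  n ℕ.+ n ℕ.* d₂      ≡⟨ ℕₚ.*-suc n d₂ ⟨
  n ℕ.* suc d₂        ≤⟨ ℕₚ.*-monoʳ-≤ n d₂<b ⟩
  n ℕ.* b             ≡⟨ ℕₚ.*-comm n b ⟩
  b ℕ.* n             ∎)
  where open ℕₚ.≤-Reasoning

balance⇒ℤ : ∀ {b e d₁ n d₂ r} → b ℕ.* e ℕ.+ d₁ ≡ n ℕ.* d₂ ℕ.+ r →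
            + b * + e - + r ≡ + n * + d₂ - + d₁
balance⇒ℤ {b} {e} {d₁} {n} {d₂} {r} h = begin
  + b * + e - + r                          ≡⟨ shift (+ b * + e) (+ r) (+ d₁) ⟩
  (+ b * + e + + d₁) - (+ d₁ + + r)        ≡⟨ cong (_- (+ d₁ + + r)) h′ ⟩
  (+ n * + d₂ + + r) - (+ d₁ + + r)        ≡⟨ cancel (+ n * + d₂) (+ d₁) (+ r) ⟩
  + n * + d₂ - + d₁                        ∎
  where
  open ≡-Reasoning
  shift : ∀ x y z → x - y ≡ (x + z) - (z + y)
  shift = ℤ-Solver.solve-∀
  cancel : ∀ x y z → (x + z) - (y + z) ≡ x - y
  cancel = ℤ-Solver.solve-∀
  h′ : + b * + e + + d₁ ≡ + n * + d₂ + + r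
  h′ = begin
    + b * + e + + d₁          ≡⟨ cong (_+ + d₁) (ℤₚ.pos-* b e) ⟨
    + (b ℕ.* e) + + d₁        ≡⟨ ℤₚ.pos-+ (b ℕ.* e) d₁ ⟨
    + (b ℕ.* e ℕ.+ d₁)        ≡⟨ cong +_ h ⟩
    + (n ℕ.* d₂ ℕ.+ r)        ≡⟨ ℤₚ.pos-+ (n ℕ.* d₂) r ⟩
    + (n ℕ.* d₂) + + r        ≡⟨ cong (_+ + r) (ℤₚ.pos-* n d₂) ⟩
    + n * + d₂ + + r          ∎

theorem3p2 : (b n : ℕ) → 1 < n → n < b → (d₁ d₂ : ℕ) → MotherEdge n b d₁ d₂ →
    Σ ℤ (λ c₁ → Σ ℤ (λ c₂ →
      (+ 0 ≤ c₁) × (c₁ ≤ + (n ∸ 1)) × (+ 0 ≤ c₂) × (c₂ ≤ + (n ∸ 1)) ×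
      (+ b * c₂ - c₁ ≡ + n * + d₂ - + d₁)))
theorem3p2 b@(suc _) n@(suc n′) _ n<b d₁ d₂ (d₁<b , d₂<b , edge) =
  + r , + e , +≤+ z≤n , +≤+ (ℕₚ.<⇒≤pred r<n) , +≤+ z≤n , +≤+ (ℕₚ.<⇒≤pred e<n) ,
  balance⇒ℤ {b} {e} {n = n} balance
  where
  n≤b : n ℕ.≤ b
  n≤b = ℕₚ.<⇒≤ n<b
  x r q e : ℕ
  x = d₁ ℕ.+ (b ∸ n) ℕ.* d₂
  r = x % b
  q = x / b
  e = d₂ ∸ q
  r<n : r < n
  r<n = s≤s (subst (λ z → leastRes b z ℕ.≤ n′) (mother-sum≡ d₁ d₂ n≤b) edge)
  balance : b ℕ.* e ℕ.+ d₁ ≡ n ℕ.* d₂ ℕ.+ r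
  balance = remainder-balance {b ∸ n} {n} {e = e} (ℕₚ.m∸n+n≡m n≤b)
              (ℕₚ.m∸n+n≡m (quotient≤ d₂ d₁<b (ℕₚ.m∸n≤m b n)))
              (sym (m≡m%n+[m/n]*n x b))
  e<n : e < n
  e<n = cofactor< balance r<n d₂<b
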